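{- Let $S\in\mathsf{SVW}_{n,m}$. Then $S$ is a highest weight element of the $\sqrt{\mathfrak{gl}_n}$-crystal $\mathsf{SVW}_{n,m}$ if and only if $\mathsf{tab}(S)$ is an increasing tableau (necessarily with entries in $[m]$ and at most $n$ rows).
   Context: $[n]=\{1,\dots,n\}$, $\mathbf{e}_k$ standard basis of $\mathbb{Z}^n$. A $\sqrt{\mathfrak{gl}_n}$-crystal is a set $\mathcal{B}$ with $\mathrm{wt}:\mathcal{B}\to\mathbb{Z}^n$ and $e_i,f_i:\mathcal{B}\to\mathcal{B}\sqcup\{0\}$ ($i\in[n-1]$) satisfying: with $\varepsilon_i(b)=\sup\{k:e_i^k(b)\ne0\}$, $\varphi_i(b)=\sup\{k:f_i^k(b)\ne0\}$, these are finite with $\frac{\varphi_i(b)-\varepsilon_i(b)}2=\mathrm{wt}(b)_i-\mathrm{wt}(b)_{i+1}$, and $e_i(b)=c$ iff $f_i(c)=b$, in which case $\mathrm{wt}(c)-\mathrm{wt}(b)=\mathbf{e}_i$ if $\varepsilon_i(b)$ even, $-\mathbf{e}_{i+1}$ if odd. Highest weight: $e_i(b)=0$ for all $i$. Tensor product: $\mathrm{wt}(b\otimes c)=\mathrm{wt}(b)+\mathrm{wt}(c)$, $e_i(b\otimes c)=b\otimes e_i(c)$ if $\varepsilon_i(b)\le\varphi_i(c)$ else $e_i(b)\otimes c$, $f_i(b\otimes c)=b\otimes f_i(c)$ if $\varepsilon_i(b)<\varphi_i(c)$ else $f_i(b)\otimes c$, with $b\otimes0=0\otimes c=0$. On subsets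 $S\subseteq[n]$ (including $\emptyset$) use $\mathrm{wt}(S)=\sum_{j\in S}\mathbf{e}_j$, $e_i(S)=S\cup\{i\}$ if $S\cap\{i,i+1\}=\{i+1\}$, $S\setminus\{i+1\}$ if $S\cap\{i,i+1\}=\{i,i+1\}$, else $0$; $f_i(S)=S\cup\{i+1\}$ if $S\cap\{i,i+1\}=\{i\}$, $S\setminus\{i\}$ if $S\cap\{i,i+1\}=\{i,i+1\}$, else $0$ (so $\emptyset$ is a trivial one-element crystal). $\mathsf{SVW}_{n,m}$ is the set of $m$-tuples $S=(S_1,\dots,S_m)$ of subsets of $[n]$, made into a $\sqrt{\mathfrak{gl}_n}$-crystal by identifying $S$ with $S_1\otimes\cdots\otimes S_m$. Tableaux use matrix coordinates (row $i$, column $j$). $\mathsf{tab}(S)$ is the left-justified tableau whose row $i$ ($i\in[n]$) lists the numbers $m+1-j$, over $j\in[m]$ with $i\in S_j$, in increasing order. An increasing tableau is a filling of the Young diagram $\{(i,j):1\le j\le\lambda_i\}$ of a partition $\lambda$ by positive integers with strictly increasing rows and columns. -}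

module Defs where

open import Data.Nat using (ℕ; zero; suc; _+_; _*_; _∸_; _≤_; _<_; _≤?_; _<?_)
open import Data.Bool using (Bool; true; false; if_then_else_)
open import Data.Bool.Properties using () renaming (_≟_ to _≟ᵇ_)
open import Data.Maybe using (Maybe; just; nothing; map)
open import Data.Vec using (Vec; []; _∷_; lookup)
open import Data.Fin using (Fin; toℕ)
open import Data.List using (List; []; _∷_; length; reverse; filter; allFin; upTo)
import Data.List as L
open import Relation.Nullary.Decidable using (does)
open import Relation.Binary.PropositionalEquality using (_≡_)

-- Subsets of [n] = {1,…,n}, as bit vectors (position k ∈ [n] is the
-- (k-1)-th entry of the vector).

Subset : ℕ → Set
Subset n = Vec Bool n

-- membership of a 1-based position k (false if k ∉ [n])
mem : ∀ {n} → Subset n → ℕ → Bool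
mem []      _             = false
mem (b ∷ v) zero          = false
mem (b ∷ v) (suc zero)    = b
mem (b ∷ v) (suc (suc k)) = mem v (suc k)

setMem : ∀ {n} → Subset n → ℕ → Bool → Subset n
setMem []      _             x = []
setMem (b ∷ v) zero          x = b ∷ v
setMem (b ∷ v) (suc zero)    x = x ∷ v
setMem (b ∷ v) (suc (suc k)) x = b ∷ setMem v (suc k) x

-- Crystal operators e_i, f_i on a single subset S ⊆ [n]  (nothing = 0)

eS : ∀ {n} → ℕ → Subset n → Maybe (Subset n)
eS i S with mem S i | mem S (suc i)
... | false | true = just (setMem S i true)
... | true  | true = just (setMem S (suc i) false)
... | _     | _    = nothing

fS : ∀ {n} → ℕ → Subset n → Maybe (Subset n)
fS i S with mem S i | mem S (suc i)
... | true | false = just (setMem S (suc i) true)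
... | true | true  = just (setMem S i false)
... | _    | _     = nothing

-- depth N g b = sup { k ≤ N : g^k(b) ≠ 0 }.  When N is at least the true
-- (finite) string length, this is exactly sup { k : g^k(b) ≠ 0 }.
depth : ∀ {A : Set} → ℕ → (A → Maybe A) → A → ℕ
depth zero    g b = zero
depth (suc N) g b with g b
... | nothing = zero
... | just b' = suc (depth N g b')

-- ε_i of a single subset: e_i^3 = 0 on subsets, so bound 2 is exact.
εS : ∀ {n} → ℕ → Subset n → ℕ
εS i S = depth 2 (eS i) S

-- SVW_{n,m}: m-tuples of subsets, S = S₁ ⊗ (S₂ ⊗ (⋯ ⊗ S_m)).
-- The empty tuple (m = 0) is the trivial one-element crystal.

SVW : ℕ → ℕ → Set
SVW n m = Vec (Subset n) m

mutual
  fT : ∀ {n} (m : ℕ) → ℕ → SVW n m → Maybe (SVW n m)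
  fT zero    i []      = nothing
  fT (suc m) i (b ∷ c) =
    if does (εS i b <? φT m i c)
    then map (b ∷_) (fT m i c)
    else map (_∷ c) (fS i b)

  -- φ_i on SVW_{n,m}.  Along an f_i-string, wt_{i+1} - wt_i increases by
  -- exactly 1 per step and lies in [-m, m], so φ_i ≤ 2m and the bound
  -- 2m+1 makes this the exact sup { k : f_i^k(c) ≠ 0 }.
  φT : ∀ {n} (m : ℕ) → ℕ → SVW n m → ℕ
  φT m i c = depth (suc (2 * m)) (fT m i) c

eT : ∀ {n} (m : ℕ) → ℕ → SVW n m → Maybe (SVW n m)
eT zero    i []      = nothing
eT (suc m) i (b ∷ c) =
  if does (εS i b ≤? φT m i c)
  then map (b ∷_) (eT m i c)
  else map (_∷ c) (eS i b)

IsHighestWeight : ∀ {n m} → SVW n m → Set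
IsHighestWeight {n} {m} S = ∀ (i : ℕ) → 1 ≤ i → i < n → eT m i S ≡ nothing

-- Tableaux: a list of rows (row 1 first), each row a list of entries
-- (column 1 first).  Matrix coordinates, here 0-based internally.

Tableau : Set
Tableau = List (List ℕ)

row : Tableau → ℕ → List ℕ
row []       _       = []
row (r ∷ rs) zero    = r
row (r ∷ rs) (suc i) = row rs i

nth : List ℕ → ℕ → Maybe ℕ
nth []       _       = nothing
nth (x ∷ xs) zero    = just x
nth (x ∷ xs) (suc j) = nth xs j

-- entry T i j = the entry in cell (i+1, j+1), if that cell exists
entry : Tableau → ℕ → ℕ → Maybe ℕ
entry T i j = nth (row T i) j

record IsIncreasingTableau (T : Tableau) : Set where
  field
    shape    : ∀ i → length (row T (suc i)) ≤ length (row T i)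
    positive : ∀ i j x → entry T i j ≡ just x → 1 ≤ x
    rowsInc  : ∀ i j x y → entry T i j ≡ just x → entry T i (suc j) ≡ just y → x < y
    colsInc  : ∀ i j x y → entry T i j ≡ just x → entry T (suc i) j ≡ just y → x < y

-- tab(S): row i (i ∈ [n]) lists the numbers m+1-j over j ∈ [m] with i ∈ S_j,
-- in increasing order.  With j = toℕ j' + 1 (j' : Fin m), m+1-j = m ∸ toℕ j';
-- these values decrease along allFin m, so reversing sorts them increasingly.
tabRow : ∀ {n m} → SVW n m → ℕ → List ℕ
tabRow {n} {m} S i =
  reverse (L.map (λ j → m ∸ toℕ j)
                 (filter (λ j → mem (lookup S j) i ≟ᵇ true) (allFin m)))

tab : ∀ {n m} → SVW n m → Tableau
tab {n} S = L.map (λ k → tabRow S (suc k)) (upTo n)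

-- On a single subset, εᵢ and φᵢ depend only on whether i and i+1 belong to it,
-- and the tensor product rule gives φᵢ(b ⊗ c) = φᵢ(b) + (φᵢ(c) ∸ εᵢ(b)), with eᵢ(b ⊗ c) = 0 iff
-- εᵢ(b) ≤ φᵢ(c) and eᵢ(c) = 0. When c is eᵢ-highest, φᵢ(c) is twice the excess of the number of
-- parts of c containing i over the number containing i+1. Hence S is eᵢ-highest iff, whenever
-- i+1 ∈ S_j, more of S_{j+1}, …, S_m contain i than contain i+1. Since S_j contributes the entry
-- m+1-j to tab(S), this lattice condition says that row i+1 of tab(S) fits strictly under row i;
-- the rows themselves are always strictly increasing with entries in [m].

module Submission where

open import Defs
open import Data.Nat using (ℕ; zero; suc; _+_; _*_; _∸_; _⊓_; _≤_; _<_; z≤n; s≤s; z<s)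
open import Data.Nat.Properties
open import Data.Bool using (Bool; true; false; if_then_else_)
open import Data.Bool.Properties using () renaming (_≟_ to _≟ᵇ_)
open import Data.Maybe using (Maybe; just; nothing)
import Data.Maybe as Maybe
open import Data.Vec using ([]; _∷_; lookup)
open import Data.Fin using (toℕ)
import Data.Fin as Fin
open import Data.List using (List; []; _∷_; _∷ʳ_; length; map; filter; reverse; allFin; applyUpTo; tabulate)
open import Data.List.Properties using (map-∘; map-tabulate; map-upTo; unfold-reverse)
open import Data.List.Relation.Unary.All as All using (All; []; _∷_)
open import Data.List.Relation.Unary.All.Properties using (∷ʳ⁺)
open import Data.List.Relation.Unary.AllPairs as AllPairs using (AllPairs; []; _∷_)
import Data.List.Relation.Unary.AllPairs.Properties as AllPairs
open import Data.Empty using (⊥-elim)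
open import Data.Product using (_×_; _,_; proj₁)
open import Function using (_∘_; id)
open import Function.Bundles using (_⇔_; mk⇔; Equivalence)
open import Function.Construct.Composition using (_⇔-∘_)
open import Function.Construct.Symmetry using (⇔-sym)
open import Relation.Nullary using (¬_; yes; no; contradiction)
open import Relation.Nullary.Decidable using (Dec; does; dec-true; dec-false)
open import Relation.Unary using (Decidable)
open import Relation.Binary.PropositionalEquality

if-yes : ∀ {P A : Set} (p? : Dec P) {x y : A} → P → (if does p? then x else y) ≡ x
if-yes p? p rewrite dec-true p? p = refl

if-no : ∀ {P A : Set} (p? : Dec P) {x y : A} → ¬ P → (if does p? then x else y) ≡ y
if-no p? ¬p rewrite dec-false p? ¬p = refl

length-∷ʳ : ∀ {A : Set} (xs : List A) x → length (xs ∷ʳ x) ≡ suc (length xs)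
length-∷ʳ []       x = refl
length-∷ʳ (_ ∷ xs) x = cong suc (length-∷ʳ xs x)

length-if-∷ʳ : ∀ {A : Set} s (xs : List A) {x} →
               length (if s then xs ∷ʳ x else xs) ≡ (if s then suc (length xs) else length xs)
length-if-∷ʳ true  xs = length-∷ʳ xs _
length-if-∷ʳ false xs = refl

filter-map : ∀ {A B : Set} {P : B → Set} (P? : Decidable P) (f : A → B) xs →
             filter P? (map f xs) ≡ map f (filter (P? ∘ f) xs)
filter-map P? f []       = refl
filter-map P? f (x ∷ xs) with does (P? (f x))
... | true  = cong (f x ∷_) (filter-map P? f xs)
... | false = filter-map P? f xs

All-nth : ∀ {P : ℕ → Set} {xs j x} → All P xs → nth xs j ≡ just x → P x
All-nth {j = zero}  (px ∷ _)   refl = px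
All-nth {j = suc j} (_  ∷ pxs) eq   = All-nth pxs eq

AllPairs-nth : ∀ {R : ℕ → ℕ → Set} {xs j x y} → AllPairs R xs → nth xs j ≡ just x → nth xs (suc j) ≡ just y → R x y
AllPairs-nth {j = zero}  ((rxy ∷ _) ∷ _) refl refl = rxy
AllPairs-nth {j = suc j} (_ ∷ rxs)       eqx  eqy  = AllPairs-nth rxs eqx eqy

-- Strings of a partial operator

module _ {A : Set} where

  StringStep : (A → ℕ) → A → Maybe A → Set
  StringStep ℓ x nothing  = ℓ x ≡ 0
  StringStep ℓ x (just y) = ℓ x ≡ suc (ℓ y)

  IsStringLength : (A → Maybe A) → (A → ℕ) → Set
  IsStringLength g ℓ = ∀ x → StringStep ℓ x (g x)

  depth≡⊓ : ∀ {g ℓ} → IsStringLength g ℓ → ∀ N x → depth N g x ≡ N ⊓ ℓ x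
  depth≡⊓         isLen zero    x = refl
  depth≡⊓ {g} {ℓ} isLen (suc N) x with g x | isLen x
  ... | nothing | ℓx≡0    rewrite ℓx≡0    = refl
  ... | just y  | ℓx≡1+ℓy rewrite ℓx≡1+ℓy = cong suc (depth≡⊓ isLen N y)

  depth≡stringLength : ∀ {g ℓ} → IsStringLength g ℓ → ∀ {N} x → ℓ x ≤ N → depth N g x ≡ ℓ x
  depth≡stringLength isLen {N} x ℓx≤N = trans (depth≡⊓ isLen N x) (m≥n⇒m⊓n≡n ℓx≤N)

-- Tableau rows

infix 4 _▷_

-- ys fits strictly under xs, i.e. as the next row of an increasing tableau.
data _▷_ : List ℕ → List ℕ → Set where
  []  : ∀ {xs} → xs ▷ []
  _∷_ : ∀ {x y xs ys} → x < y → xs ▷ ys → x ∷ xs ▷ y ∷ ys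

▷-length : ∀ {xs ys} → xs ▷ ys → length ys ≤ length xs
▷-length []      = z≤n
▷-length (_ ∷ p) = s≤s (▷-length p)

▷-nth : ∀ {xs ys} → xs ▷ ys → ∀ j x y → nth xs j ≡ just x → nth ys j ≡ just y → x < y
▷-nth (x<y ∷ _) zero    _ _ refl refl = x<y
▷-nth (_   ∷ p) (suc j)               = ▷-nth p j

nth⇒▷ : ∀ {xs ys} → length ys ≤ length xs → (∀ j x y → nth xs j ≡ just x → nth ys j ≡ just y → x < y) → xs ▷ ys
nth⇒▷ {ys = []}          _           _  = []
nth⇒▷ {x ∷ xs} {y ∷ ys} (s≤s ys≤xs) lt = lt 0 x y refl refl ∷ nth⇒▷ ys≤xs (λ j → lt (suc j))

▷-∷ʳˡ : ∀ {xs ys z} → xs ▷ ys → xs ∷ʳ z ▷ ys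
▷-∷ʳˡ []        = []
▷-∷ʳˡ (x<y ∷ p) = x<y ∷ ▷-∷ʳˡ p

▷-∷ʳˡ⁻ : ∀ {xs ys z} → All (_< z) ys → xs ∷ʳ z ▷ ys → xs ▷ ys
▷-∷ʳˡ⁻ {[]}    _          []        = []
▷-∷ʳˡ⁻ {[]}    (y<z ∷ _)  (z<y ∷ _) = ⊥-elim (<-asym y<z z<y)
▷-∷ʳˡ⁻ {_ ∷ _} _          []        = []
▷-∷ʳˡ⁻ {_ ∷ _} (_ ∷ ys<z) (x<y ∷ p) = x<y ∷ ▷-∷ʳˡ⁻ ys<z p

▷-∷ʳʳ : ∀ {xs ys z} → All (_< z) xs → length ys < length xs → xs ▷ ys → xs ▷ ys ∷ʳ z
▷-∷ʳʳ (x<z ∷ _)  _           []        = x<z ∷ []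
▷-∷ʳʳ (_ ∷ xs<z) (s≤s ys<xs) (x<y ∷ p) = x<y ∷ ▷-∷ʳʳ xs<z ys<xs p

▷-∷ʳʳ⁻ : ∀ {xs ys z} → xs ▷ ys ∷ʳ z → xs ▷ ys × length ys < length xs
▷-∷ʳʳ⁻ {ys = []}    (_ ∷ _)   = [] , s≤s z≤n
▷-∷ʳʳ⁻ {ys = _ ∷ _} (x<y ∷ p) with ▷-∷ʳʳ⁻ p
... | q , ys<xs = x<y ∷ q , s≤s ys<xs

▷-∷ʳ⁻ : ∀ {xs ys z} → xs ∷ʳ z ▷ ys ∷ʳ z → xs ▷ ys × length ys < length xs
▷-∷ʳ⁻ {[]}    {[]}        (z<z ∷ _) = ⊥-elim (<-irrefl refl z<z)
▷-∷ʳ⁻ {[]}    {_ ∷ []}    (_ ∷ ())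
▷-∷ʳ⁻ {[]}    {_ ∷ _ ∷ _} (_ ∷ ())
▷-∷ʳ⁻ {_ ∷ _} {[]}        (_ ∷ _)   = [] , s≤s z≤n
▷-∷ʳ⁻ {_ ∷ _} {_ ∷ _}     (x<y ∷ p) with ▷-∷ʳ⁻ p
... | q , ys<xs = x<y ∷ q , s≤s ys<xs

▷-if-∷ʳ : ∀ s t {xs ys z} → All (_< z) xs → All (_< z) ys →
          (if s then xs ∷ʳ z else xs) ▷ (if t then ys ∷ʳ z else ys) ⇔ (xs ▷ ys × (t ≡ true → length ys < length xs))
▷-if-∷ʳ false false _    _    = mk⇔ (λ p → p , λ ()) proj₁
▷-if-∷ʳ true  false _    ys<z = mk⇔ (λ p → ▷-∷ʳˡ⁻ ys<z p , λ ()) (▷-∷ʳˡ ∘ proj₁)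
▷-if-∷ʳ false true  xs<z _    = mk⇔ (λ p → let q , ys<xs = ▷-∷ʳʳ⁻ p in q , λ _ → ys<xs)
                                     (λ (q , ys<xs) → ▷-∷ʳʳ xs<z (ys<xs refl) q)
▷-if-∷ʳ true  true  xs<z _    = mk⇔ (λ p → let q , ys<xs = ▷-∷ʳ⁻ p in q , λ _ → ys<xs)
                                     (λ (q , ys<xs) → ▷-∷ʳˡ (▷-∷ʳʳ xs<z (ys<xs refl) q))

-- Subsets and the rows of tab(S)

mem-setMem-≡ : ∀ {n} (v : Subset n) {k} x → 1 ≤ k → k ≤ n → mem (setMem v k x) k ≡ x
mem-setMem-≡ (b ∷ v) {suc zero}    x _ _         = refl
mem-setMem-≡ (b ∷ v) {suc (suc k)} x _ (s≤s k<n) = mem-setMem-≡ v x (s≤s z≤n) k<n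

mem-setMem-≢ : ∀ {n} (v : Subset n) {k k′} x → k ≢ k′ → mem (setMem v k x) k′ ≡ mem v k′
mem-setMem-≢ []      {k}           {k′}           x k≢k′ = refl
mem-setMem-≢ (b ∷ v) {zero}        {k′}           x k≢k′ = refl
mem-setMem-≢ (b ∷ v) {suc zero}    {zero}         x k≢k′ = refl
mem-setMem-≢ (b ∷ v) {suc zero}    {suc zero}     x k≢k′ = ⊥-elim (k≢k′ refl)
mem-setMem-≢ (b ∷ v) {suc zero}    {suc (suc k′)} x k≢k′ = refl
mem-setMem-≢ (b ∷ v) {suc (suc k)} {zero}         x k≢k′ = refl
mem-setMem-≢ (b ∷ v) {suc (suc k)} {suc zero}     x k≢k′ = refl
mem-setMem-≢ (b ∷ v) {suc (suc k)} {suc (suc k′)} x k≢k′ =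
  mem-setMem-≢ v x (λ k≡k′ → k≢k′ (cong suc k≡k′))

mem-beyond : ∀ {n} (v : Subset n) {k} → n ≤ k → mem v (suc k) ≡ false
mem-beyond []      _         = refl
mem-beyond (b ∷ v) (s≤s n≤k) = mem-beyond v n≤k

tabRow′ : ∀ {n m} → SVW n m → ℕ → List ℕ
tabRow′ []                  i = []
tabRow′ {m = suc m} (b ∷ c) i = if mem b i then tabRow′ c i ∷ʳ suc m else tabRow′ c i

tabRow-tail : ∀ {n m} b (c : SVW n m) i →
              map (λ j → suc m ∸ toℕ j) (filter (λ j → mem (lookup (b ∷ c) j) i ≟ᵇ true) (tabulate Fin.suc))
              ≡ map (λ j → m ∸ toℕ j) (filter (λ j → mem (lookup c j) i ≟ᵇ true) (allFin m))
tabRow-tail {m = m} b c i = begin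
  map f (filter P? (tabulate Fin.suc))                   ≡⟨ cong (map f ∘ filter P?) (map-tabulate id Fin.suc) ⟨
  map f (filter P? (map Fin.suc (allFin m)))             ≡⟨ cong (map f) (filter-map P? Fin.suc (allFin m)) ⟩
  map f (map Fin.suc (filter (P? ∘ Fin.suc) (allFin m))) ≡⟨ map-∘ (filter (P? ∘ Fin.suc) (allFin m)) ⟨
  map (f ∘ Fin.suc) (filter (P? ∘ Fin.suc) (allFin m))   ∎
  where
    open ≡-Reasoning
    f = λ j → suc m ∸ toℕ j
    P? = λ j → mem (lookup (b ∷ c) j) i ≟ᵇ true

tabRow-∷ : ∀ {n m} b (c : SVW n m) i → tabRow (b ∷ c) i ≡ (if mem b i then tabRow c i ∷ʳ suc m else tabRow c i)
tabRow-∷ {m = m} b c i with mem b i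
... | true  = trans (cong (reverse ∘ (suc m ∷_)) (tabRow-tail b c i))
                    (unfold-reverse (suc m) (map (λ j → m ∸ toℕ j) (filter (λ j → mem (lookup c j) i ≟ᵇ true) (allFin m))))
... | false = cong reverse (tabRow-tail b c i)

tabRow≡tabRow′ : ∀ {n m} (S : SVW n m) i → tabRow S i ≡ tabRow′ S i
tabRow≡tabRow′ []      i = refl
tabRow≡tabRow′ (b ∷ c) i rewrite tabRow-∷ b c i | tabRow≡tabRow′ c i = refl

tabRow′-< : ∀ {n m} (c : SVW n m) i → All (_< suc m) (tabRow′ c i)
tabRow′-< []      i = []
tabRow′-< (b ∷ c) i with mem b i
... | true  = ∷ʳ⁺ (All.map m<n⇒m<1+n (tabRow′-< c i)) ≤-refl
... | false = All.map m<n⇒m<1+n (tabRow′-< c i)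

tabRow′-positive : ∀ {n m} (c : SVW n m) i → All (0 <_) (tabRow′ c i)
tabRow′-positive []      i = []
tabRow′-positive (b ∷ c) i with mem b i
... | true  = ∷ʳ⁺ (tabRow′-positive c i) z<s
... | false = tabRow′-positive c i

tabRow′-increasing : ∀ {n m} (c : SVW n m) i → AllPairs _<_ (tabRow′ c i)
tabRow′-increasing []      i = []
tabRow′-increasing (b ∷ c) i with mem b i
... | true  = AllPairs.++⁺ (tabRow′-increasing c i) ([] ∷ []) (All.map (_∷ []) (tabRow′-< c i))
... | false = tabRow′-increasing c i

tabRow′-beyond : ∀ {n m} (c : SVW n m) {k} → n ≤ k → tabRow′ c (suc k) ≡ []
tabRow′-beyond []      n≤k = refl
tabRow′-beyond (b ∷ c) n≤k rewrite mem-beyond b n≤k = tabRow′-beyond c n≤k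

row-applyUpTo : ∀ (h : ℕ → List ℕ) n → (∀ {k} → n ≤ k → h k ≡ []) → ∀ k → row (applyUpTo h n) k ≡ h k
row-applyUpTo h zero    h≡[] k       = sym (h≡[] z≤n)
row-applyUpTo h (suc n) h≡[] zero    = refl
row-applyUpTo h (suc n) h≡[] (suc k) = row-applyUpTo (h ∘ suc) n (h≡[] ∘ s≤s) k

row-tab : ∀ {n m} (S : SVW n m) k → row (tab S) k ≡ tabRow′ S (suc k)
row-tab {n} S k = begin
  row (tab S) k                                 ≡⟨ cong (λ T → row T k) (map-upTo (λ k → tabRow S (suc k)) n) ⟩
  row (applyUpTo (λ k → tabRow S (suc k)) n) k  ≡⟨ row-applyUpTo _ n tabRow-beyond k ⟩
  tabRow S (suc k)                              ≡⟨ tabRow≡tabRow′ S (suc k) ⟩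
  tabRow′ S (suc k)                             ∎
  where
    open ≡-Reasoning
    tabRow-beyond : ∀ {k} → n ≤ k → tabRow S (suc k) ≡ []
    tabRow-beyond n≤k = trans (tabRow≡tabRow′ S _) (tabRow′-beyond S n≤k)

-- The i-strings of SVW

-- εᵢ and φᵢ of a subset S in terms of (i ∈ S , i+1 ∈ S): the i-string is {i} → {i,i+1} → {i+1}.
εᵇ φᵇ : Bool → Bool → ℕ
εᵇ _     false = 0
εᵇ false true  = 2
εᵇ true  true  = 1
φᵇ false _     = 0
φᵇ true  false = 2
φᵇ true  true  = 1

φᵇ-step : ∀ s t {p q} → q ≤ p → (t ≡ true → q < p) →
          (2 * (p ∸ q) ∸ εᵇ s t) + φᵇ s t ≡ 2 * ((if s then suc p else p) ∸ (if t then suc q else q))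
φᵇ-step false false                 _   _   = +-identityʳ _
φᵇ-step true  false {p} {q}         q≤p _   = begin
  2 * (p ∸ q) + 2    ≡⟨ +-comm _ 2 ⟩
  2 + 2 * (p ∸ q)    ≡⟨ *-suc 2 (p ∸ q) ⟨
  2 * suc (p ∸ q)    ≡⟨ cong (2 *_) (+-∸-assoc 1 q≤p) ⟨
  2 * (suc p ∸ q)    ∎
  where open ≡-Reasoning
φᵇ-step false true  {p} {q}         _   q<p = begin
  (2 * (p ∸ q) ∸ 2) + 0       ≡⟨ +-identityʳ _ ⟩
  2 * (p ∸ q) ∸ 2             ≡⟨ cong (λ d → 2 * d ∸ 2) (+-∸-assoc 1 (q<p refl)) ⟩
  2 * suc (p ∸ suc q) ∸ 2     ≡⟨ cong (_∸ 2) (*-suc 2 (p ∸ suc q)) ⟩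
  2 * (p ∸ suc q)             ∎
  where open ≡-Reasoning
φᵇ-step true  true                  _   q<p =
  m∸n+n≡m (≤-trans (s≤s z≤n) (*-monoʳ-≤ 2 (m<n⇒0<n∸m (q<p refl))))

εᵇ≤2*⇔ : ∀ s t d → εᵇ s t ≤ 2 * d ⇔ (t ≡ true → 0 < d)
εᵇ≤2*⇔ _     false _       = mk⇔ (λ _ ()) (λ _ → z≤n)
εᵇ≤2*⇔ false true  zero    = mk⇔ (λ ()) (λ 0<0 → contradiction (0<0 refl) n≮0)
εᵇ≤2*⇔ true  true  zero    = mk⇔ (λ ()) (λ 0<0 → contradiction (0<0 refl) n≮0)
εᵇ≤2*⇔ false true  (suc d) = mk⇔ (λ _ _ → z<s) (λ _ → *-monoʳ-≤ 2 (s≤s z≤n))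
εᵇ≤2*⇔ true  true  (suc d) = mk⇔ (λ _ _ → z<s) (λ _ → s≤s z≤n)

-- For i = 0 or i = n the operators eS i and fS i are degenerate (setMem ignores positions 0 and n+1).
module _ {n : ℕ} (i : ℕ) (1≤i : 1 ≤ i) (i<n : i < n) where

  εₛ φₛ : Subset n → ℕ
  εₛ b = εᵇ (mem b i) (mem b (suc i))
  φₛ b = φᵇ (mem b i) (mem b (suc i))

  private
    mem-i-setMem-i : ∀ (b : Subset n) x → mem (setMem b i x) i ≡ x
    mem-i-setMem-i b x = mem-setMem-≡ b x 1≤i (<⇒≤ i<n)

    mem-i+1-setMem-i+1 : ∀ (b : Subset n) x → mem (setMem b (suc i) x) (suc i) ≡ x
    mem-i+1-setMem-i+1 b x = mem-setMem-≡ b x (s≤s z≤n) i<n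

    mem-i+1-setMem-i : ∀ (b : Subset n) x → mem (setMem b i x) (suc i) ≡ mem b (suc i)
    mem-i+1-setMem-i b x = mem-setMem-≢ b x (1+n≢n ∘ sym)

    mem-i-setMem-i+1 : ∀ (b : Subset n) x → mem (setMem b (suc i) x) i ≡ mem b i
    mem-i-setMem-i+1 b x = mem-setMem-≢ b x 1+n≢n

  eS-stringLength : IsStringLength (eS i) εₛ
  eS-stringLength b with mem b i in p | mem b (suc i) in q
  ... | false | true  rewrite mem-i-setMem-i b true | mem-i+1-setMem-i b true | p | q = refl
  ... | true  | true  rewrite mem-i+1-setMem-i+1 b false | p | q = refl
  ... | true  | false rewrite q = refl
  ... | false | false rewrite q = refl

  fS-stringLength : IsStringLength (fS i) φₛ
  fS-stringLength b with mem b i in p | mem b (suc i) in q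
  ... | true  | false rewrite mem-i+1-setMem-i+1 b true | mem-i-setMem-i+1 b true | p | q = refl
  ... | true  | true  rewrite mem-i-setMem-i b false | p | q = refl
  ... | false | true  rewrite p = refl
  ... | false | false rewrite p = refl

  fS-suc-εₛ : ∀ {b b′} → fS i b ≡ just b′ → εₛ b′ ≡ suc (εₛ b)
  fS-suc-εₛ {b} fb≡b′ with mem b i in p | mem b (suc i) in q | fb≡b′
  ... | true  | false | refl rewrite mem-i+1-setMem-i+1 b true | mem-i-setMem-i+1 b true | p | q = refl
  ... | true  | true  | refl rewrite mem-i-setMem-i b false | mem-i+1-setMem-i b false | p | q = refl

  εₛ≤2 : ∀ b → εₛ b ≤ 2
  εₛ≤2 b with mem b i | mem b (suc i)
  ... | _     | false = z≤n
  ... | false | true  = ≤-refl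
  ... | true  | true  = s≤s z≤n

  φₛ≤2 : ∀ b → φₛ b ≤ 2
  φₛ≤2 b with mem b i | mem b (suc i)
  ... | false | _     = z≤n
  ... | true  | false = ≤-refl
  ... | true  | true  = s≤s z≤n

  εS≡εₛ : ∀ b → εS i b ≡ εₛ b
  εS≡εₛ b = depth≡stringLength eS-stringLength b (εₛ≤2 b)

  φₜ : ∀ {m} → SVW n m → ℕ
  φₜ []      = 0
  φₜ (b ∷ c) = (φₜ c ∸ εₛ b) + φₛ b

  -- φT counts at most 2m+1 applications of fT, so this bound makes it exact.
  φₜ≤2m : ∀ {m} (c : SVW n m) → φₜ c ≤ 2 * m
  φₜ≤2m {suc m} (b ∷ c) = begin
    (φₜ c ∸ εₛ b) + φₛ b ≤⟨ +-mono-≤ (m∸n≤m (φₜ c) (εₛ b)) (φₛ≤2 b) ⟩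
    φₜ c + 2             ≤⟨ +-monoˡ-≤ 2 (φₜ≤2m c) ⟩
    2 * m + 2            ≡⟨ +-comm (2 * m) 2 ⟩
    2 + 2 * m            ≡⟨ *-suc 2 m ⟨
    2 * suc m            ∎
    where open ≤-Reasoning
  φₜ≤2m [] = z≤n

  -- fT on b ∷ c consults φT of the tail, so string lengths and φT are established together.
  mutual
    fT-stringLength : ∀ {m} → IsStringLength (fT m i) (φₜ {m})
    fT-stringLength [] = refl
    fT-stringLength {suc m} (b ∷ c) with εₛ b <? φₜ c
    ... | yes ε<φ rewrite fT-∷-< b c ε<φ with fT m i c | fT-stringLength c
    ...   | nothing | φc≡0     = contradiction (subst (εₛ b <_) φc≡0 ε<φ) n≮0
    ...   | just c′ | φc≡1+φc′ rewrite φc≡1+φc′ =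
      cong (_+ φₛ b) (+-∸-assoc 1 (≤-pred ε<φ))
    fT-stringLength {suc m} (b ∷ c) | no ε≮φ rewrite fT-∷-≮ b c ε≮φ
      with fS i b in fb | fS-stringLength b
    ... | nothing | φb≡0 rewrite m≤n⇒m∸n≡0 (≮⇒≥ ε≮φ) = φb≡0
    ... | just b′ | φb≡1+φb′
      rewrite fS-suc-εₛ fb | m≤n⇒m∸n≡0 (≮⇒≥ ε≮φ) | m≤n⇒m∸n≡0 (m≤n⇒m≤1+n (≮⇒≥ ε≮φ)) = φb≡1+φb′

    φT≡φₜ : ∀ {m} (c : SVW n m) → φT m i c ≡ φₜ c
    φT≡φₜ c = depth≡stringLength fT-stringLength c (m≤n⇒m≤1+n (φₜ≤2m c))

    fT-∷-< : ∀ {m} b (c : SVW n m) → εₛ b < φₜ c → fT (suc m) i (b ∷ c) ≡ Maybe.map (b ∷_) (fT m i c)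
    fT-∷-< b c ε<φ = if-yes (εS i b <? φT _ i c) (subst₂ _<_ (sym (εS≡εₛ b)) (sym (φT≡φₜ c)) ε<φ)

    fT-∷-≮ : ∀ {m} b (c : SVW n m) → ¬ εₛ b < φₜ c → fT (suc m) i (b ∷ c) ≡ Maybe.map (_∷ c) (fS i b)
    fT-∷-≮ b c ε≮φ = if-no (εS i b <? φT _ i c) (ε≮φ ∘ subst₂ _<_ (εS≡εₛ b) (φT≡φₜ c))

  eT-∷-≤ : ∀ {m} b (c : SVW n m) → εₛ b ≤ φₜ c → eT (suc m) i (b ∷ c) ≡ Maybe.map (b ∷_) (eT m i c)
  eT-∷-≤ b c ε≤φ = if-yes (εS i b ≤? φT _ i c) (subst₂ _≤_ (sym (εS≡εₛ b)) (sym (φT≡φₜ c)) ε≤φ)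

  eT-∷-≰ : ∀ {m} b (c : SVW n m) → ¬ εₛ b ≤ φₜ c → eT (suc m) i (b ∷ c) ≡ Maybe.map (_∷ c) (eS i b)
  eT-∷-≰ b c ε≰φ = if-no (εS i b ≤? φT _ i c) (ε≰φ ∘ subst₂ _≤_ (εS≡εₛ b) (φT≡φₜ c))

  eT-∷≡nothing⁻ : ∀ {m} b (c : SVW n m) → eT (suc m) i (b ∷ c) ≡ nothing → εₛ b ≤ φₜ c × eT m i c ≡ nothing
  eT-∷≡nothing⁻ {m} b c with εₛ b ≤? φₜ c
  ... | yes ε≤φ rewrite eT-∷-≤ b c ε≤φ with eT m i c
  ...   | nothing = λ _ → ε≤φ , refl
  ...   | just _  = λ ()
  eT-∷≡nothing⁻ b c | no ε≰φ rewrite eT-∷-≰ b c ε≰φ with eS i b | eS-stringLength b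
  ... | nothing | εb≡0 = λ _ → contradiction (subst (_≤ φₜ c) (sym εb≡0) z≤n) ε≰φ
  ... | just _  | _    = λ ()

  eT-∷≡nothing⁺ : ∀ {m} b (c : SVW n m) → εₛ b ≤ φₜ c → eT m i c ≡ nothing → eT (suc m) i (b ∷ c) ≡ nothing
  eT-∷≡nothing⁺ b c ε≤φ ec≡nothing rewrite eT-∷-≤ b c ε≤φ | ec≡nothing = refl

  ▷⇒φₜ≡2*∸ : ∀ {m} (c : SVW n m) → tabRow′ c i ▷ tabRow′ c (suc i) →
              φₜ c ≡ 2 * (length (tabRow′ c i) ∸ length (tabRow′ c (suc i)))
  ▷⇒φₜ≡2*∸ []      _ = refl
  ▷⇒φₜ≡2*∸ (b ∷ c) d with Equivalence.to (▷-if-∷ʳ (mem b i) (mem b (suc i)) (tabRow′-< c i) (tabRow′-< c (suc i))) d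
  ... | d′ , ballot = begin
    (φₜ c ∸ εₛ b) + φₛ b
      ≡⟨ cong (λ φ → (φ ∸ εₛ b) + φₛ b) (▷⇒φₜ≡2*∸ c d′) ⟩
    (2 * (length xs ∸ length ys) ∸ εₛ b) + φₛ b
      ≡⟨ φᵇ-step (mem b i) (mem b (suc i)) (▷-length d′) ballot ⟩
    2 * ((if mem b i then suc (length xs) else length xs) ∸ (if mem b (suc i) then suc (length ys) else length ys))
      ≡⟨ cong₂ (λ p q → 2 * (p ∸ q)) (length-if-∷ʳ (mem b i) xs) (length-if-∷ʳ (mem b (suc i)) ys) ⟨
    2 * (length (tabRow′ (b ∷ c) i) ∸ length (tabRow′ (b ∷ c) (suc i))) ∎
    where
      open ≡-Reasoning
      xs = tabRow′ c i
      ys = tabRow′ c (suc i)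

  εₛ≤φₜ⇔ : ∀ {m} b (c : SVW n m) → tabRow′ c i ▷ tabRow′ c (suc i) →
           εₛ b ≤ φₜ c ⇔ (mem b (suc i) ≡ true → length (tabRow′ c (suc i)) < length (tabRow′ c i))
  εₛ≤φₜ⇔ b c d rewrite ▷⇒φₜ≡2*∸ c d = mk⇔
    (λ ε≤φ t → m∸n≢0⇒n<m (n>0⇒n≢0 (Equivalence.to (εᵇ≤2*⇔ _ _ _) ε≤φ t)))
    (λ ballot → Equivalence.from (εᵇ≤2*⇔ _ _ _) (λ t → m<n⇒0<n∸m (ballot t)))

  eT≡nothing⇒▷ : ∀ {m} (c : SVW n m) → eT m i c ≡ nothing → tabRow′ c i ▷ tabRow′ c (suc i)
  eT≡nothing⇒▷ []      _ = []
  eT≡nothing⇒▷ (b ∷ c) e with eT-∷≡nothing⁻ b c e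
  ... | ε≤φ , e′ = Equivalence.from (▷-if-∷ʳ (mem b i) (mem b (suc i)) (tabRow′-< c i) (tabRow′-< c (suc i)))
                     (d , Equivalence.to (εₛ≤φₜ⇔ b c d) ε≤φ)
    where d = eT≡nothing⇒▷ c e′

  ▷⇒eT≡nothing : ∀ {m} (c : SVW n m) → tabRow′ c i ▷ tabRow′ c (suc i) → eT m i c ≡ nothing
  ▷⇒eT≡nothing []      _  = refl
  ▷⇒eT≡nothing (b ∷ c) d′ with Equivalence.to (▷-if-∷ʳ (mem b i) (mem b (suc i)) (tabRow′-< c i) (tabRow′-< c (suc i))) d′
  ... | d , ballot = eT-∷≡nothing⁺ b c (Equivalence.from (εₛ≤φₜ⇔ b c d) ballot) (▷⇒eT≡nothing c d)

-- Highest weight elements and increasing tableaux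

isIncreasingTableau⇔▷ : ∀ (T : Tableau) → (∀ k → All (0 <_) (row T k)) → (∀ k → AllPairs _<_ (row T k)) →
                         IsIncreasingTableau T ⇔ (∀ k → row T k ▷ row T (suc k))
isIncreasingTableau⇔▷ T positive increasing = mk⇔
  (λ t k → let open IsIncreasingTableau t in nth⇒▷ (shape k) (colsInc k))
  (λ rows▷ → record
    { shape    = λ k → ▷-length (rows▷ k)
    ; positive = λ k _ _ → All-nth (positive k)
    ; rowsInc  = λ k _ _ _ → AllPairs-nth (increasing k)
    ; colsInc  = λ k → ▷-nth (rows▷ k)
    })

highestWeight⇔rows▷ : ∀ {n m} (S : SVW n m) → IsHighestWeight S ⇔ (∀ k → row (tab S) k ▷ row (tab S) (suc k))
highestWeight⇔rows▷ {n} S = mk⇔ to from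
  where
    to : IsHighestWeight S → ∀ k → row (tab S) k ▷ row (tab S) (suc k)
    to hw k rewrite row-tab S k | row-tab S (suc k) with suc k <? n
    ... | yes 1+k<n = eT≡nothing⇒▷ (suc k) z<s 1+k<n S (hw (suc k) z<s 1+k<n)
    ... | no  1+k≮n rewrite tabRow′-beyond S (≮⇒≥ 1+k≮n) = []

    from : (∀ k → row (tab S) k ▷ row (tab S) (suc k)) → IsHighestWeight S
    from rows▷ (suc k) _ 1+k<n =
      ▷⇒eT≡nothing (suc k) z<s 1+k<n S (subst₂ _▷_ (row-tab S k) (row-tab S (suc k)) (rows▷ k))

increasingTableau⇔rows▷ : ∀ {n m} (S : SVW n m) → IsIncreasingTableau (tab S) ⇔ (∀ k → row (tab S) k ▷ row (tab S) (suc k))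
increasingTableau⇔rows▷ S = isIncreasingTableau⇔▷ (tab S)
  (λ k → subst (All (0 <_)) (sym (row-tab S k)) (tabRow′-positive S (suc k)))
  (λ k → subst (AllPairs _<_) (sym (row-tab S k)) (tabRow′-increasing S (suc k)))

proposition2p17 : (n m : ℕ) (S : SVW n m) → IsHighestWeight S ⇔ IsIncreasingTableau (tab S)
proposition2p17 n m S = ⇔-sym (increasingTableau⇔rows▷ S) ⇔-∘ highestWeight⇔rows▷ S
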